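{- Let $k>1$ be an odd integer and $\ell$ an integer with $k<\ell<\sqrt3k$ and $\gcd(k,\ell)=1$; let $u,v\ge 0$ be integers with $k^2u-\ell^2v=\pm1$; let $g\in\{2,4\}$, where if $g=4$ we also require $\ell$ odd. Put $d_1(n)=k^2(1+2n)+gv$, $d_2(n)=\ell^2(1+2n)+gu$ and $f(n)=d_1(n)d_2(n)$. For a prime $p$ let $w_f(p)$ be the number of integers $a$ with $1\le a\le p^2$ such that $f(a)\equiv 0\pmod{p^2}$. Then $w_f(2)=0$; for odd primes $p$ with $p\mid k$ or $p\mid\ell$ one has $w_f(p)=1$; and for all other primes $w_f(p)=2$.
   Context: Here $u,v$ are as produced by the extended Euclidean algorithm: $u=|g_0|$, $v=|h_0|$ for integers $g_0,h_0$ with $k^2g_0+\ell^2h_0=1$. -}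

module Defs where

open import Data.Nat using (ℕ; suc; _+_; _*_)
open import Data.Nat.Divisibility using (_∣?_)
open import Data.List using (List; length; filter; map; upTo)

d₁ : (k ℓ u v g : ℕ) → ℕ → ℕ
d₁ k ℓ u v g n = k * k * (1 + 2 * n) + g * v

d₂ : (k ℓ u v g : ℕ) → ℕ → ℕ
d₂ k ℓ u v g n = ℓ * ℓ * (1 + 2 * n) + g * u

f : (k ℓ u v g : ℕ) → ℕ → ℕ
f k ℓ u v g n = d₁ k ℓ u v g n * d₂ k ℓ u v g n

range1 : ℕ → List ℕ
range1 m = map suc (upTo m)

w : (k ℓ u v g : ℕ) → ℕ → ℕ
w k ℓ u v g p = length (filter (λ a → (p * p) ∣? f k ℓ u v g a) (range1 (p * p)))

{-# OPTIONS --safe #-}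
module Submission where

-- Both factors are linear in a: d₁(a) = 2k²·a + (k² + gv) and d₂(a) = 2ℓ²·a + (ℓ² + gu),
-- so modulo p² each has exactly one root in [1, p²] as soon as p ∤ 2k, resp. p ∤ 2ℓ.
-- Multiplying out, k²u − ℓ²v = ±1 becomes k²d₂(a) − ℓ²d₁(a) = ±g.  Hence an odd prime
-- never divides both factors, so the roots of f modulo p² are the disjoint union of those
-- of d₁ and of d₂, and an odd prime dividing k (resp. ℓ) never divides d₁ (resp. d₂).
-- For p = 2: d₁ is odd, and 4 ∤ d₂ because either ℓ is odd and then so is d₂, or g = 2
-- and 4 ∣ ℓ², so that 4 ∣ d₂ would give 4 ∣ g.

open import Defs
open import Data.Nat using (ℕ; zero; suc; _+_; _*_; _∸_; _<_; _≤_; z<s; s<s; NonZero)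
open import Data.Nat.Properties
open import Data.Nat.Divisibility
open import Data.Nat.DivMod using (_%_; _/_; m≡m%n+[m/n]*n; m%n<n)
open import Data.Nat.GCD using (gcd; module Bézout)
open import Data.Nat.Coprimality
  using (Coprime; gcd≡1⇒coprime; coprime-divisor; coprime-factors; coprime-Bézout)
import Data.Nat.Coprimality as Coprimality
open import Data.Nat.Primality
  using (Prime; euclidsLemma; prime⇒irreducible; prime⇒nonZero; ¬prime[1]; prime[2])
open import Data.Nat.Tactic.RingSolver using (solve-∀)
open import Data.Empty using (⊥-elim)
open import Data.Product using (_×_; _,_; proj₁; proj₂; ∃-syntax)
open import Data.Sum using (_⊎_; inj₁; inj₂; [_,_])
import Data.Sum as Sum
open import Data.List using ([]; _∷_; length; filter; map; upTo)
open import Data.List.Properties using (filter-none; filter-≐)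
open import Data.List.Membership.Propositional using (_∈_)
open import Data.List.Membership.Propositional.Properties using (∈-map⁺; ∈-map⁻; ∈-upTo⁺; ∈-upTo⁻)
import Data.List.Relation.Unary.All as All
open import Data.List.Relation.Unary.Any using (here; there)
open import Data.List.Relation.Unary.AllPairs using (_∷_)
open import Data.List.Relation.Unary.Unique.Propositional using (Unique)
open import Data.List.Relation.Unary.Unique.Propositional.Properties using (map⁺; upTo⁺)
open import Function using (_∘_; id)
open import Level using (Level)
open import Relation.Binary.PropositionalEquality hiding ([_])
open import Relation.Nullary using (¬_; yes; no; contradiction)
open import Relation.Unary using (Pred; Decidable; _≐_; _∪_; _⊥_)

module _ {a p : Level} {A : Set a} {P : Pred A p} (P? : Decidable P) where

  length-filter≡1 : ∀ {xs x} → Unique xs → x ∈ xs → P x → (∀ {y} → y ∈ xs → P y → y ≡ x) →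
                    length (filter P? xs) ≡ 1
  length-filter≡1 {y ∷ xs} (y∉xs ∷ xs!) x∈ Px only-x with P? y
  ... | yes Py = cong (suc ∘ length) (filter-none P? (All.tabulate ¬P))
    where
    ¬P : ∀ {z} → z ∈ xs → ¬ P z
    ¬P z∈xs Pz = All.lookup y∉xs z∈xs (trans (only-x (here refl) Py) (sym (only-x (there z∈xs) Pz)))
  ... | no ¬Py with x∈
  ...   | here refl  = contradiction Px ¬Py
  ...   | there x∈xs = length-filter≡1 xs! x∈xs Px (only-x ∘ there)

module _ {a p q r : Level} {A : Set a} {P : Pred A p} {Q : Pred A q} {R : Pred A r}
         (P? : Decidable P) (Q? : Decidable Q) (R? : Decidable R)
         (P≐Q∪R : P ≐ Q ∪ R) (Q⊥R : Q ⊥ R) where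

  length-filter-∪ : ∀ xs → length (filter P? xs) ≡ length (filter Q? xs) + length (filter R? xs)
  length-filter-∪ []       = refl
  length-filter-∪ (x ∷ xs) with P? x | Q? x | R? x
  ... | _      | yes Qx | yes Rx = ⊥-elim (Q⊥R (Qx , Rx))
  ... | yes _  | yes _  | no _   = cong suc (length-filter-∪ xs)
  ... | yes _  | no _   | yes _  = trans (cong suc (length-filter-∪ xs)) (sym (+-suc _ _))
  ... | yes Px | no ¬Qx | no ¬Rx = ⊥-elim ([ ¬Qx , ¬Rx ] (proj₁ P≐Q∪R Px))
  ... | no ¬Px | yes Qx | no _   = contradiction (proj₂ P≐Q∪R (inj₁ Qx)) ¬Px
  ... | no ¬Px | no _   | yes Rx = contradiction (proj₂ P≐Q∪R (inj₂ Rx)) ¬Px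
  ... | no _   | no _   | no _   = length-filter-∪ xs

range1-unique : ∀ m → Unique (range1 m)
range1-unique m = map⁺ suc-injective (upTo⁺ m)

∈-range1⁺ : ∀ {m r} → r < m → suc r ∈ range1 m
∈-range1⁺ r<m = ∈-map⁺ suc (∈-upTo⁺ r<m)

∈-range1⁻ : ∀ {m a} → a ∈ range1 m → 0 < a × a ≤ m
∈-range1⁻ a∈ with _ , r∈ , refl ← ∈-map⁻ suc a∈ = z<s , ∈-upTo⁻ r∈

range1-representative : ∀ m a → ∃[ b ] b ∈ range1 (suc m) × ∃[ q ] b + q * suc m ≡ a + 1 * suc m
range1-representative m a = suc r , ∈-range1⁺ (m%n<n (a + m) (suc m)) , q , b+qM≡a+M
  where
  r = (a + m) % suc m
  q = (a + m) / suc m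
  b+qM≡a+M : suc r + q * suc m ≡ a + 1 * suc m
  b+qM≡a+M = begin
    suc (r + q * suc m) ≡⟨ cong suc (m≡m%n+[m/n]*n (a + m) (suc m)) ⟨
    suc (a + m)         ≡⟨ +-suc a m ⟨
    a + suc m           ≡⟨ cong (a +_) (*-identityˡ (suc m)) ⟨
    a + 1 * suc m       ∎
    where open ≡-Reasoning

∣∧<⇒≡0 : ∀ {m n} → m ∣ n → n < m → n ≡ 0
∣∧<⇒≡0 {n = zero}  _   _   = refl
∣∧<⇒≡0 {n = suc n} m∣n n<m = contradiction m∣n (>⇒∤ n<m)

∣-gap : ∀ {d m n c} → d ∣ m → d ∣ n → m ≡ n + c ⊎ n ≡ m + c → d ∣ c
∣-gap d∣m d∣n (inj₁ m≡n+c) = ∣m+n∣m⇒∣n (subst (_ ∣_) m≡n+c d∣m) d∣n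
∣-gap d∣m d∣n (inj₂ n≡m+c) = ∣m+n∣m⇒∣n (subst (_ ∣_) n≡m+c d∣n) d∣m

prime∣prime⇒≡ : ∀ {p q} → Prime p → Prime q → p ∣ q → p ≡ q
prime∣prime⇒≡ pp pq p∣q with prime⇒irreducible pq p∣q
... | inj₁ refl = contradiction pp ¬prime[1]
... | inj₂ p≡q  = p≡q

odd-prime∤2 : ∀ {p} → Prime p → p ≢ 2 → p ∤ 2
odd-prime∤2 pp p≢2 = p≢2 ∘ prime∣prime⇒≡ pp prime[2]

∤-* : ∀ {p m n} → Prime p → p ∤ m → p ∤ n → p ∤ m * n
∤-* {m = m} {n} pp p∤m p∤n p∣mn = [ p∤m , p∤n ] (euclidsLemma m n pp p∣mn)

prime∤⇒coprime : ∀ {p n} → Prime p → p ∤ n → Coprime p n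
prime∤⇒coprime pp p∤n (i∣p , i∣n) with prime⇒irreducible pp i∣p
... | inj₁ i≡1 = i≡1
... | inj₂ refl = contradiction i∣n p∤n

prime∣coprime⇒∤ : ∀ {p m n} → Prime p → Coprime m n → p ∣ m → p ∤ n
prime∣coprime⇒∤ pp m⊥n p∣m p∣n = contradiction (m⊥n (p∣m , p∣n)) (λ { refl → ¬prime[1] pp })

coprime-*ˡ : ∀ {m n o} → Coprime m n → Coprime o n → Coprime (m * o) n
coprime-*ˡ {o = o} m⊥n o⊥n (i∣mo , i∣n) =
  o⊥n (coprime-factors m⊥n (i∣mo , ∣-trans i∣n (m∣m*n o)) , i∣n)

prime²∣*∧∤ˡ⇒∣ʳ : ∀ {p m n} → Prime p → p ∤ m → p * p ∣ m * n → p * p ∣ n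
prime²∣*∧∤ˡ⇒∣ʳ pp p∤m = coprime-divisor (coprime-*ˡ p⊥m p⊥m)
  where p⊥m = prime∤⇒coprime pp p∤m

prime²∣*⇒∣⊎∣ : ∀ {p m n} → Prime p → (p ∣ m → p ∤ n) → p * p ∣ m * n → p * p ∣ m ⊎ p * p ∣ n
prime²∣*⇒∣⊎∣ {p} {m} {n} pp m⊥n p²∣mn with p ∣? m
... | yes p∣m = inj₁ (prime²∣*∧∤ˡ⇒∣ʳ pp (m⊥n p∣m) (subst (p * p ∣_) (*-comm m n) p²∣mn))
... | no  p∤m = inj₂ (prime²∣*∧∤ˡ⇒∣ʳ pp p∤m p²∣mn)

2∤1+2a : ∀ a → 2 ∤ 1 + 2 * a
2∤1+2a a 2∣1+2a = >⇒∤ (s<s z<s) (∣m+n∣m⇒∣n (subst (2 ∣_) (+-comm 1 (2 * a)) 2∣1+2a) (m∣m*n a))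

2∤x*x*[1+2a]+G : ∀ {x G} a → 2 ∤ x → 2 ∣ G → 2 ∤ x * x * (1 + 2 * a) + G
2∤x*x*[1+2a]+G {x} {G} a 2∤x 2∣G 2∣sum =
  ∤-* prime[2] (∤-* prime[2] 2∤x 2∤x) (2∤1+2a a)
    (∣m+n∣m⇒∣n (subst (2 ∣_) (+-comm (x * x * (1 + 2 * a)) G) 2∣sum) 2∣G)

coprime⇒∃[x]∣t*x+1 : ∀ {t m} → Coprime t (suc m) → ∃[ x ] suc m ∣ t * x + 1
coprime⇒∃[x]∣t*x+1 {t} {m} t⊥M with coprime-Bézout t⊥M
... | Bézout.-+ x y 1+xt≡yM = x , divides y (trans (flip t x) 1+xt≡yM)
  where
  flip : ∀ t x → t * x + 1 ≡ 1 + x * t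
  flip = solve-∀
... | Bézout.+- x y 1+yM≡xt = x * m , divides (1 + y * m) (begin
  t * (x * m) + 1           ≡⟨ cong (_+ 1) (*-assoc-comm t x m) ⟩
  x * t * m + 1             ≡⟨ cong (λ z → z * m + 1) 1+yM≡xt ⟨
  (1 + y * suc m) * m + 1   ≡⟨ regroup y m ⟩
  (1 + y * m) * suc m       ∎)
  where
  open ≡-Reasoning
  *-assoc-comm : ∀ t x m → t * (x * m) ≡ x * t * m
  *-assoc-comm = solve-∀
  regroup : ∀ y m → (1 + y * suc m) * m + 1 ≡ (1 + y * m) * suc m
  regroup = solve-∀

*-distribˡ-+-under-+ : ∀ t C x y → t * (x + y) + C ≡ t * x + C + t * y
*-distribˡ-+-under-+ = solve-∀

linear-root-shift : ∀ {m t C a b i j} → a + i * m ≡ b + j * m → m ∣ t * a + C → m ∣ t * b + C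
linear-root-shift {m} {t} {C} {a} {b} {i} {j} a+im≡b+jm m∣ta+C =
  ∣m+n∣m⇒∣n (subst (m ∣_) regroup (∣m∣n⇒∣m+n m∣ta+C (n∣m*n (t * i)))) (n∣m*n (t * j))
  where
  open ≡-Reasoning
  regroup : t * a + C + t * i * m ≡ t * j * m + (t * b + C)
  regroup = begin
    t * a + C + t * i * m     ≡⟨ cong (t * a + C +_) (*-assoc t i m) ⟩
    t * a + C + t * (i * m)   ≡⟨ *-distribˡ-+-under-+ t C a (i * m) ⟨
    t * (a + i * m) + C       ≡⟨ cong (λ z → t * z + C) a+im≡b+jm ⟩
    t * (b + j * m) + C       ≡⟨ *-distribˡ-+-under-+ t C b (j * m) ⟩
    t * b + C + t * (j * m)   ≡⟨ +-comm (t * b + C) (t * (j * m)) ⟩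
    t * (j * m) + (t * b + C) ≡⟨ cong (_+ (t * b + C)) (*-assoc t j m) ⟨
    t * j * m + (t * b + C)   ∎

linear-root-exists : ∀ {m t} C → Coprime t (suc m) → ∃[ a ] a ∈ range1 (suc m) × suc m ∣ t * a + C
linear-root-exists {m} {t} C t⊥M with coprime⇒∃[x]∣t*x+1 t⊥M
... | x , M∣tx+1 with range1-representative m (x * C)
...   | b , b∈ , q , b+qM≡xC+M =
  b , b∈ , linear-root-shift {suc m} {t} {C} {x * C} {b} {1} {q} (sym b+qM≡xC+M) M∣txC+C
  where
  factor : ∀ t x C → (t * x + 1) * C ≡ t * (x * C) + C
  factor = solve-∀
  M∣txC+C : suc m ∣ t * (x * C) + C
  M∣txC+C = subst (suc m ∣_) (factor t x C) (∣m⇒∣m*n C M∣tx+1)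

linear-root-unique : ∀ {m t C a b} → Coprime m t → 0 < a → a ≤ b → b ≤ m →
                     m ∣ t * a + C → m ∣ t * b + C → a ≡ b
linear-root-unique {m} {t} {C} {a} {b} m⊥t 0<a a≤b b≤m m∣ta+C m∣tb+C = begin
  a           ≡⟨ +-identityʳ a ⟨
  a + 0       ≡⟨ cong (a +_) d≡0 ⟨
  a + (b ∸ a) ≡⟨ a+d≡b ⟩
  b           ∎
  where
  open ≡-Reasoning
  d = b ∸ a
  a+d≡b : a + d ≡ b
  a+d≡b = m+[n∸m]≡n a≤b
  m∣td : m ∣ t * d
  m∣td = ∣m+n∣m⇒∣n (subst (m ∣_) tb+C≡ta+C+td m∣tb+C) m∣ta+C
    where
    tb+C≡ta+C+td = trans (cong (λ z → t * z + C) (sym a+d≡b)) (*-distribˡ-+-under-+ t C a d)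
  d<m : d < m
  d<m = <-≤-trans (m<n+m d 0<a) (subst (_≤ m) (sym a+d≡b) b≤m)
  d≡0 : d ≡ 0
  d≡0 = ∣∧<⇒≡0 (coprime-divisor m⊥t m∣td) d<m

rootCount : ℕ → (ℕ → ℕ) → ℕ
rootCount m h = length (filter (λ a → m ∣? h a) (range1 m))

rootCount-cong : ∀ {m h h′} → (∀ a → h a ≡ h′ a) → rootCount m h ≡ rootCount m h′
rootCount-cong {m} h≗h′ =
  cong length (filter-≐ _ _ (to , from) (range1 m))
  where
  to   = λ {a} → subst (m ∣_) (h≗h′ a)
  from = λ {a} → subst (m ∣_) (sym (h≗h′ a))

rootCount≡0 : ∀ {m h} → (∀ a → m ∤ h a) → rootCount m h ≡ 0
rootCount≡0 {m} {h} m∤h =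
  cong length (filter-none (λ a → m ∣? h a) {range1 m} (All.tabulate λ {a} _ → m∤h a))

linear-rootCount : ∀ {m t C} .{{_ : NonZero m}} → Coprime m t → rootCount m (λ a → t * a + C) ≡ 1
linear-rootCount {suc m} {t} {C} M⊥t = counted (linear-root-exists C (Coprimality.sym M⊥t))
  where
  M = suc m
  ≤⇒≡ : ∀ {x y} → x ∈ range1 M → y ∈ range1 M → x ≤ y → M ∣ t * x + C → M ∣ t * y + C → x ≡ y
  ≤⇒≡ x∈ y∈ x≤y = linear-root-unique M⊥t (proj₁ (∈-range1⁻ x∈)) x≤y (proj₂ (∈-range1⁻ y∈))
  counted : ∃[ a ] a ∈ range1 M × M ∣ t * a + C → rootCount M (λ a → t * a + C) ≡ 1
  counted (a , a∈ , root) =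
    length-filter≡1 (λ b → M ∣? t * b + C) {range1 M} (range1-unique M) a∈ root only-a
    where
    only-a : ∀ {b} → b ∈ range1 M → M ∣ t * b + C → b ≡ a
    only-a {b} b∈ b-root with ≤-total b a
    ... | inj₁ b≤a = ≤⇒≡ b∈ a∈ b≤a b-root root
    ... | inj₂ a≤b = sym (≤⇒≡ a∈ b∈ a≤b root b-root)

rootCount-* : ∀ {p h₁ h₂} → Prime p → (∀ a → p ∣ h₁ a → p ∤ h₂ a) →
              rootCount (p * p) (λ a → h₁ a * h₂ a) ≡ rootCount (p * p) h₁ + rootCount (p * p) h₂
rootCount-* {p} {h₁} {h₂} pp h₁⊥h₂ =
  length-filter-∪ (λ a → p * p ∣? h₁ a * h₂ a) (λ a → p * p ∣? h₁ a) (λ a → p * p ∣? h₂ a)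
    ((λ {a} → prime²∣*⇒∣⊎∣ pp (h₁⊥h₂ a)) , λ {a} → [ ∣m⇒∣m*n (h₂ a) , ∣n⇒∣m*n (h₁ a) ])
    (λ {a} (p²∣h₁ , p²∣h₂) → h₁⊥h₂ a (∣-trans (m∣m*n p) p²∣h₁) (∣-trans (m∣m*n p) p²∣h₂))
    (range1 (p * p))

odd-prime-rootCount : ∀ {p x G} → Prime p → p ≢ 2 → p ∤ x →
                      rootCount (p * p) (λ a → x * x * (1 + 2 * a) + G) ≡ 1
odd-prime-rootCount {p} {x} {G} pp p≢2 p∤x = begin
  rootCount (p * p) (λ a → x * x * (1 + 2 * a) + G)
    ≡⟨ rootCount-cong {p * p} (linear (x * x) G) ⟩
  rootCount (p * p) (λ a → 2 * (x * x) * a + (x * x + G))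
    ≡⟨ linear-rootCount {p * p} {{m*n≢0 p p}} (coprime-*ˡ p⊥2x² p⊥2x²) ⟩
  1 ∎
  where
  open ≡-Reasoning
  instance _ = prime⇒nonZero pp
  linear : ∀ K G a → K * (1 + 2 * a) + G ≡ 2 * K * a + (K + G)
  linear = solve-∀
  p⊥2x² : Coprime p (2 * (x * x))
  p⊥2x² = prime∤⇒coprime pp (∤-* pp (odd-prime∤2 pp p≢2) (∤-* pp p∤x p∤x))

cross-multiply : ∀ g K L N x y → K * x ≡ L * y + 1 → K * (L * N + g * x) ≡ L * (K * N + g * y) + g
cross-multiply g K L N x y Kx≡Ly+1 = begin
  K * (L * N + g * x)         ≡⟨ expandˡ g K L N x ⟩
  K * L * N + g * (K * x)     ≡⟨ cong (λ z → K * L * N + g * z) Kx≡Ly+1 ⟩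
  K * L * N + g * (L * y + 1) ≡⟨ expandʳ g K L N y ⟩
  L * (K * N + g * y) + g     ∎
  where
  open ≡-Reasoning
  expandˡ : ∀ g K L N x → K * (L * N + g * x) ≡ K * L * N + g * (K * x)
  expandˡ = solve-∀
  expandʳ : ∀ g K L N y → K * L * N + g * (L * y + 1) ≡ L * (K * N + g * y) + g
  expandʳ = solve-∀

module Factors {k ℓ u v g : ℕ} (2∤k : 2 ∤ k)
               (unit : k * k * u ≡ ℓ * ℓ * v + 1 ⊎ ℓ * ℓ * v ≡ k * k * u + 1)
               (g≡2⊎g≡4 : g ≡ 2 ⊎ (g ≡ 4 × 2 ∤ ℓ)) where

  D₁ D₂ : ℕ → ℕ
  D₁ = d₁ k ℓ u v g
  D₂ = d₂ k ℓ u v g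

  k²d₂≡ℓ²d₁±g : ∀ a → k * k * D₂ a ≡ ℓ * ℓ * D₁ a + g ⊎ ℓ * ℓ * D₁ a ≡ k * k * D₂ a + g
  k²d₂≡ℓ²d₁±g a =
    Sum.map (cross-multiply g (k * k) (ℓ * ℓ) (1 + 2 * a) u v)
            (cross-multiply g (ℓ * ℓ) (k * k) (1 + 2 * a) v u) unit

  ∣k²d₂∧∣ℓ²d₁⇒∣g : ∀ {q} a → q ∣ k * k * D₂ a → q ∣ ℓ * ℓ * D₁ a → q ∣ g
  ∣k²d₂∧∣ℓ²d₁⇒∣g a q∣k²d₂ q∣ℓ²d₁ = ∣-gap q∣k²d₂ q∣ℓ²d₁ (k²d₂≡ℓ²d₁±g a)

  ∤g∧∣k⇒∤d₁ : ∀ {q} a → q ∤ g → q ∣ k → q ∤ D₁ a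
  ∤g∧∣k⇒∤d₁ a q∤g q∣k q∣d₁ =
    q∤g (∣k²d₂∧∣ℓ²d₁⇒∣g a (∣m⇒∣m*n (D₂ a) (∣m⇒∣m*n k q∣k)) (∣n⇒∣m*n (ℓ * ℓ) q∣d₁))

  ∤g∧∣ℓ⇒∤d₂ : ∀ {q} a → q ∤ g → q ∣ ℓ → q ∤ D₂ a
  ∤g∧∣ℓ⇒∤d₂ a q∤g q∣ℓ q∣d₂ =
    q∤g (∣k²d₂∧∣ℓ²d₁⇒∣g a (∣n⇒∣m*n (k * k) q∣d₂) (∣m⇒∣m*n (D₁ a) (∣m⇒∣m*n ℓ q∣ℓ)))

  ∤g∧∣d₁⇒∤d₂ : ∀ {q} a → q ∤ g → q ∣ D₁ a → q ∤ D₂ a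
  ∤g∧∣d₁⇒∤d₂ a q∤g q∣d₁ q∣d₂ =
    q∤g (∣k²d₂∧∣ℓ²d₁⇒∣g a (∣n⇒∣m*n (k * k) q∣d₂) (∣n⇒∣m*n (ℓ * ℓ) q∣d₁))

  2∣g : 2 ∣ g
  2∣g = [ (λ g≡2 → subst (2 ∣_) (sym g≡2) ∣-refl)
        , (λ (g≡4 , _) → subst (2 ∣_) (sym g≡4) (m∣m*n 2)) ] g≡2⊎g≡4

  odd-prime∤g : ∀ {p} → Prime p → p ≢ 2 → p ∤ g
  odd-prime∤g {p} pp p≢2 =
    [ (λ g≡2 → subst (p ∤_) (sym g≡2) p∤2)
    , (λ (g≡4 , _) → subst (p ∤_) (sym g≡4) (∤-* pp p∤2 p∤2)) ] g≡2⊎g≡4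
    where p∤2 = odd-prime∤2 pp p≢2

  2∤d₁ : ∀ a → 2 ∤ D₁ a
  2∤d₁ a = 2∤x*x*[1+2a]+G a 2∤k (∣m⇒∣m*n v 2∣g)

  2∣ℓ⇒g≡2 : 2 ∣ ℓ → g ≡ 2
  2∣ℓ⇒g≡2 2∣ℓ = [ id , (λ (_ , 2∤ℓ) → contradiction 2∣ℓ 2∤ℓ) ] g≡2⊎g≡4

  4∤d₂ : ∀ a → 4 ∤ D₂ a
  4∤d₂ a with 2 ∣? ℓ
  ... | no 2∤ℓ  = 2∤x*x*[1+2a]+G a 2∤ℓ (∣m⇒∣m*n u 2∣g) ∘ ∣-trans (m∣m*n 2)
  ... | yes 2∣ℓ = λ 4∣d₂ → 4∤2 (subst (4 ∣_) (2∣ℓ⇒g≡2 2∣ℓ)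
          (∣k²d₂∧∣ℓ²d₁⇒∣g a (∣n⇒∣m*n (k * k) 4∣d₂) (∣m⇒∣m*n (D₁ a) (*-pres-∣ 2∣ℓ 2∣ℓ))))
    where
    4∤2 : 4 ∤ 2
    4∤2 = >⇒∤ (s<s (s<s z<s))

  w[2]≡0 : w k ℓ u v g 2 ≡ 0
  w[2]≡0 = rootCount≡0 {4} {f k ℓ u v g} λ a 4∣f → 4∤d₂ a (prime²∣*∧∤ˡ⇒∣ʳ prime[2] (2∤d₁ a) 4∣f)

  w≡rootCount-d₁+rootCount-d₂ : ∀ {p} → Prime p → p ≢ 2 →
                                w k ℓ u v g p ≡ rootCount (p * p) D₁ + rootCount (p * p) D₂
  w≡rootCount-d₁+rootCount-d₂ {p} pp p≢2 =
    rootCount-* {p} {D₁} {D₂} pp (λ a → ∤g∧∣d₁⇒∤d₂ a (odd-prime∤g pp p≢2))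

  rootCount-d₁≡0 : ∀ {p} → Prime p → p ≢ 2 → p ∣ k → rootCount (p * p) D₁ ≡ 0
  rootCount-d₁≡0 {p} pp p≢2 p∣k = rootCount≡0 {p * p} {D₁} λ a p²∣d₁ →
    ∤g∧∣k⇒∤d₁ a (odd-prime∤g pp p≢2) p∣k (∣-trans (m∣m*n p) p²∣d₁)

  rootCount-d₂≡0 : ∀ {p} → Prime p → p ≢ 2 → p ∣ ℓ → rootCount (p * p) D₂ ≡ 0
  rootCount-d₂≡0 {p} pp p≢2 p∣ℓ = rootCount≡0 {p * p} {D₂} λ a p²∣d₂ →
    ∤g∧∣ℓ⇒∤d₂ a (odd-prime∤g pp p≢2) p∣ℓ (∣-trans (m∣m*n p) p²∣d₂)

  rootCount-d₁≡1 : ∀ {p} → Prime p → p ≢ 2 → p ∤ k → rootCount (p * p) D₁ ≡ 1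
  rootCount-d₁≡1 {p} = odd-prime-rootCount {p} {k} {g * v}

  rootCount-d₂≡1 : ∀ {p} → Prime p → p ≢ 2 → p ∤ ℓ → rootCount (p * p) D₂ ≡ 1
  rootCount-d₂≡1 {p} = odd-prime-rootCount {p} {ℓ} {g * u}

lemma6p4 : (k ℓ u v g : ℕ) →
    1 < k → ¬ (2 ∣ k) →
    k < ℓ → ℓ * ℓ < 3 * (k * k) →
    gcd k ℓ ≡ 1 →
    (k * k * u ≡ ℓ * ℓ * v + 1 ⊎ ℓ * ℓ * v ≡ k * k * u + 1) →
    (g ≡ 2 ⊎ (g ≡ 4 × ¬ (2 ∣ ℓ))) →
    (w k ℓ u v g 2 ≡ 0)
    × (∀ p → Prime p → p ≢ 2 → (p ∣ k ⊎ p ∣ ℓ) → w k ℓ u v g p ≡ 1)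
    × (∀ p → Prime p → p ≢ 2 → ¬ (p ∣ k) → ¬ (p ∣ ℓ) → w k ℓ u v g p ≡ 2)
lemma6p4 k ℓ u v g _ 2∤k _ _ gcd[k,ℓ]≡1 unit g≡2⊎g≡4 = w[2]≡0 , w[p]≡1 , w[p]≡2
  where
  open Factors 2∤k unit g≡2⊎g≡4
  k⊥ℓ : Coprime k ℓ
  k⊥ℓ = gcd≡1⇒coprime gcd[k,ℓ]≡1

  w[p]≡1 : ∀ p → Prime p → p ≢ 2 → p ∣ k ⊎ p ∣ ℓ → w k ℓ u v g p ≡ 1
  w[p]≡1 p pp p≢2 (inj₁ p∣k) = trans (w≡rootCount-d₁+rootCount-d₂ pp p≢2)
    (cong₂ _+_ (rootCount-d₁≡0 pp p≢2 p∣k)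
               (rootCount-d₂≡1 pp p≢2 (prime∣coprime⇒∤ pp k⊥ℓ p∣k)))
  w[p]≡1 p pp p≢2 (inj₂ p∣ℓ) = trans (w≡rootCount-d₁+rootCount-d₂ pp p≢2)
    (cong₂ _+_ (rootCount-d₁≡1 pp p≢2 (prime∣coprime⇒∤ pp (Coprimality.sym k⊥ℓ) p∣ℓ))
               (rootCount-d₂≡0 pp p≢2 p∣ℓ))

  w[p]≡2 : ∀ p → Prime p → p ≢ 2 → p ∤ k → p ∤ ℓ → w k ℓ u v g p ≡ 2
  w[p]≡2 p pp p≢2 p∤k p∤ℓ = trans (w≡rootCount-d₁+rootCount-d₂ pp p≢2)
    (cong₂ _+_ (rootCount-d₁≡1 pp p≢2 p∤k) (rootCount-d₂≡1 pp p≢2 p∤ℓ))
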